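{- The equation $x^2+y^2=z$ is not partition regular on $\mathbb{N}$: there is a finite partition $\mathbb{N}=C_1\sqcup\cdots\sqcup C_r$ such that no $C_i$ contains $x,y,z$ with $x^2+y^2=z$.
   Context: A polynomial equation $F(X_1,\ldots,X_n)=0$ with integer coefficients is partition regular on $\mathbb{N}$ if for every finite partition $\mathbb{N}=C_1\sqcup\cdots\sqcup C_r$ there are $i$ and $x_1,\ldots,x_n\in C_i$ (not necessarily distinct) with $F(x_1,\ldots,x_n)=0$. -}

module Defs where

open import Data.Nat using (ℕ; suc; _≤_)
open import Data.Integer using (ℤ; +_; _+_; _*_; _-_; 0ℤ)
open import Data.Fin using (Fin; zero; suc)
open import Data.Product using (Σ; ∃; _×_; _,_)
open import Relation.Binary.PropositionalEquality using (_≡_)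
open import Relation.Nullary using (¬_)

-- The paper's ℕ = {1,2,3,...}.  A finite partition ℕ = C_1 ⊔ ... ⊔ C_r is
-- given by a colouring χ : ℕ → Fin r (C_i = {m ≥ 1 | χ m = i}; the value
-- of χ at 0 is irrelevant since all solutions are required to be ≥ 1).
-- An integer polynomial in n variables is represented by the function it
-- induces on integer tuples, (Fin n → ℤ) → ℤ.

PartitionRegular : (n : ℕ) → ((Fin n → ℤ) → ℤ) → Set
PartitionRegular n F =
  (r : ℕ) (χ : ℕ → Fin r) →
  Σ (Fin r) λ i → Σ (Fin n → ℕ) λ x →
    ((k : Fin n) → 1 ≤ x k) × ((k : Fin n) → χ (x k) ≡ i) ×
    (F (λ k → + (x k)) ≡ 0ℤ)

sumOfSquaresMinus : (Fin 3 → ℤ) → ℤ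
sumOfSquaresMinus v =
  v zero * v zero + v (suc zero) * v (suc zero) - v (suc (suc zero))

module Submission where

-- Idea: group the integers n ≥ 2 into the blocks [T k, T (k+1)) of the tower
-- T k = 2^(2^k) (so T (k+1) = (T k)²), call k the level of n, and colour n by
-- its level mod 3, giving 1 a fourth colour of its own.  If x, y ≥ 2 and
-- level x ≤ level y = b, then z = x² + y² satisfies
--   T (b+1) = (T b)² ≤ y² ≤ z < 2·(T (b+1))² = 2·T (b+2) ≤ T (b+3),
-- so level z is b+1 or b+2 and z has a different colour from y.  When one of
-- x, y is 1, then z ≥ 2 already differs in colour from it.

open import Defs
open import Data.Nat using (ℕ; _≤_)
open import Data.Fin using (Fin; zero; suc)
open import Data.Integer using (+_; 0ℤ)
open import Data.Product using (Σ; _×_)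
open import Relation.Binary.PropositionalEquality using (_≡_)
open import Relation.Nullary using (¬_)

open import Data.Nat using (suc; _+_; _*_; _<_; _⊔_; z≤n; s≤s; _≤?_)
open import Data.Nat.Properties
open import Data.Fin.Properties using () renaming (suc-injective to Fin-suc-injective)
import Data.Integer as ℤ
import Data.Integer.Properties as ℤ
open import Data.Product using (_,_; proj₁; proj₂)
open import Data.Sum using (_⊎_; inj₁; inj₂)
open import Data.Empty using (⊥)
open import Relation.Nullary using (yes; no)
open import Relation.Binary.PropositionalEquality
  using (_≢_; refl; sym; trans; cong; cong₂; subst; module ≡-Reasoning)

double≤square : ∀ a → 2 ≤ a → a + a ≤ a * a
double≤square a 2≤a = subst (_≤ a * a) (cong (_+_ a) (+-identityʳ a)) (*-monoˡ-≤ a 2≤a)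

n≤n*n : ∀ n → n ≤ n * n
n≤n*n 0         = z≤n
n≤n*n n@(suc _) = m≤m*n n n

between-succ : ∀ {m n} → m ≤ n → n ≤ suc m → n ≡ m ⊎ n ≡ suc m
between-succ m≤n n≤1+m with m≤n⇒m<n∨m≡n n≤1+m
... | inj₁ n<1+m = inj₁ (≤-antisym (≤-pred n<1+m) m≤n)
... | inj₂ n≡1+m = inj₂ n≡1+m

T : ℕ → ℕ
T 0       = 2
T (suc k) = T k * T k

T-≥2 : ∀ k → 2 ≤ T k
T-≥2 0       = ≤-refl
T-≥2 (suc k) = ≤-trans (T-≥2 k) (n≤n*n (T k))

T-mono-≤ : ∀ {p q} → p ≤ q → T p ≤ T q
T-mono-≤ {q = q} z≤n = T-≥2 q
T-mono-≤ (s≤s p≤q)   = *-mono-≤ (T-mono-≤ p≤q) (T-mono-≤ p≤q)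

T-<-suc : ∀ k → T k < T (suc k)
T-<-suc k = <-≤-trans (m<m+n (T k) (≤-trans (s≤s z≤n) (T-≥2 k)))
                      (double≤square (T k) (T-≥2 k))

T-reflects-< : ∀ {p q} → T p < T q → p < q
T-reflects-< Tp<Tq = ≰⇒> (λ q≤p → <⇒≱ Tp<Tq (T-mono-≤ q≤p))

-- The level of n is the largest k with T k ≤ n (and 0 for n < 2); it is
-- computed by raising the level of n - 1 whenever the next tower value is hit.
level : ℕ → ℕ
level 0 = 0
level (suc n) with T (suc (level n)) ≤? suc n
... | yes _ = suc (level n)
... | no  _ = level n

level-bracket : ∀ n → T (level n) ≤ n ⊔ 2 × n < T (suc (level n))
level-bracket 0 = ≤-refl , ≤-trans (s≤s z≤n) (T-≥2 1)
level-bracket (suc n) with T (suc (level n)) ≤? suc n | level-bracket n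
... | yes hit  | _ , n<T = ≤-trans hit (m≤m⊔n (suc n) 2) , <-≤-trans (s≤s n<T) (T-<-suc (suc (level n)))
... | no  miss | T≤ , _ = ≤-trans T≤ (⊔-monoˡ-≤ 2 (n≤1+n n)) , ≰⇒> miss

level-upper : ∀ n → n < T (suc (level n))
level-upper n = proj₂ (level-bracket n)

level-lower : ∀ {n} → 2 ≤ n → T (level n) ≤ n
level-lower {n} 2≤n = subst (T (level n) ≤_) (m≥n⇒m⊔n≡m 2≤n) (proj₁ (level-bracket n))

level-≥ : ∀ {k n} → T k ≤ n → k ≤ level n
level-≥ {n = n} Tk≤n = ≤-pred (T-reflects-< (≤-<-trans Tk≤n (level-upper n)))

level-< : ∀ {k n} → 2 ≤ n → n < T k → level n < k
level-< 2≤n n<Tk = T-reflects-< (≤-<-trans (level-lower 2≤n) n<Tk)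

level-sumOfSquares : ∀ {x y} → 2 ≤ x → 2 ≤ y → level x ≤ level y →
  let b = level y ; c = level (x * x + y * y) in suc b ≤ c × c ≤ suc (suc b)
level-sumOfSquares {x} {y} 2≤x 2≤y lx≤ly = level-≥ z-above , ≤-pred (level-< 2≤z z-below)
  where
  b : ℕ
  b = level y
  z : ℕ
  z = x * x + y * y
  Ty≤y : T b ≤ y
  Ty≤y = level-lower 2≤y
  z-above : T (suc b) ≤ z
  z-above = ≤-trans (*-mono-≤ Ty≤y Ty≤y) (m≤n+m (y * y) (x * x))
  2≤z : 2 ≤ z
  2≤z = ≤-trans (T-≥2 (suc b)) z-above
  x-below : x < T (suc b)
  x-below = <-≤-trans (level-upper x) (T-mono-≤ (s≤s lx≤ly))
  z-below : z < T (suc (suc (suc b)))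
  z-below = <-≤-trans (+-mono-< (*-mono-< x-below x-below) (*-mono-< (level-upper y) (level-upper y)))
                      (double≤square (T (suc (suc b))) (T-≥2 (suc (suc b))))

mod3 : ℕ → Fin 3
mod3 0                   = zero
mod3 1                   = suc zero
mod3 2                   = suc (suc zero)
mod3 (suc (suc (suc n))) = mod3 n

mod3-step₁ : ∀ b → mod3 (suc b) ≢ mod3 b
mod3-step₁ 0                   ()
mod3-step₁ 1                   ()
mod3-step₁ 2                   ()
mod3-step₁ (suc (suc (suc b))) = mod3-step₁ b

mod3-step₂ : ∀ b → mod3 (suc (suc b)) ≢ mod3 b
mod3-step₂ 0                   ()
mod3-step₂ 1                   ()
mod3-step₂ 2                   ()
mod3-step₂ (suc (suc (suc b))) = mod3-step₂ b

mod3-separates : ∀ {b c} → suc b ≤ c → c ≤ suc (suc b) → mod3 c ≢ mod3 b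
mod3-separates {b} lo hi with between-succ lo hi
... | inj₁ refl = mod3-step₁ b
... | inj₂ refl = mod3-step₂ b

colour : ℕ → Fin 4
colour 0             = zero
colour 1             = zero
colour (suc (suc n)) = suc (mod3 (level (suc (suc n))))

colour-large : ∀ {n} → 2 ≤ n → colour n ≡ suc (mod3 (level n))
colour-large {suc (suc n)} (s≤s (s≤s z≤n)) = refl

colour-large-class : ∀ {n m} → 2 ≤ m → colour n ≡ colour m → 2 ≤ n
colour-large-class {0}           {suc (suc m)} (s≤s (s≤s z≤n)) ()
colour-large-class {1}           {suc (suc m)} (s≤s (s≤s z≤n)) ()
colour-large-class {suc (suc n)} _                            _ = s≤s (s≤s z≤n)

colour-sumOfSquares : ∀ {x y} → 2 ≤ x → 2 ≤ y → level x ≤ level y →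
  colour (x * x + y * y) ≢ colour y
colour-sumOfSquares {x} {y} 2≤x 2≤y lx≤ly same =
  mod3-separates (proj₁ bounds) (proj₂ bounds) (Fin-suc-injective (begin
    suc (mod3 (level (x * x + y * y))) ≡⟨ sym (colour-large 2≤z) ⟩
    colour (x * x + y * y)             ≡⟨ same ⟩
    colour y                           ≡⟨ colour-large 2≤y ⟩
    suc (mod3 (level y))               ∎))
  where
  open ≡-Reasoning
  bounds : suc (level y) ≤ level (x * x + y * y) × level (x * x + y * y) ≤ suc (suc (level y))
  bounds = level-sumOfSquares 2≤x 2≤y lx≤ly
  2≤z : 2 ≤ x * x + y * y
  2≤z = ≤-trans 2≤y (≤-trans (n≤n*n y) (m≤n+m (y * y) (x * x)))

no-monochromatic-solution : ∀ {x y z} → 1 ≤ x → 1 ≤ y →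
  colour x ≡ colour z → colour y ≡ colour z → x * x + y * y ≡ z → ⊥
no-monochromatic-solution {x} {y} 1≤x 1≤y cx cy refl = by-order (≤-total (level x) (level y))
  where
  2≤z : 2 ≤ x * x + y * y
  2≤z = +-mono-≤ (*-mono-≤ 1≤x 1≤x) (*-mono-≤ 1≤y 1≤y)
  2≤x : 2 ≤ x
  2≤x = colour-large-class 2≤z cx
  2≤y : 2 ≤ y
  2≤y = colour-large-class 2≤z cy
  -- By symmetry of x² + y², the summand of larger level plays the role of y.
  by-order : level x ≤ level y ⊎ level y ≤ level x → ⊥
  by-order (inj₁ lx≤ly) = colour-sumOfSquares 2≤x 2≤y lx≤ly (sym cy)
  by-order (inj₂ ly≤lx) = colour-sumOfSquares 2≤y 2≤x ly≤lx
    (trans (cong colour (+-comm (y * y) (x * x))) (sym cx))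

sumOfSquaresMinus-nat : ∀ x y z →
  sumOfSquaresMinus (λ { zero → + x ; (suc zero) → + y ; (suc (suc zero)) → + z }) ≡ 0ℤ →
  x * x + y * y ≡ z
sumOfSquaresMinus-nat x y z eq = ℤ.+-injective (begin
  + (x * x + y * y)           ≡⟨ ℤ.pos-+ (x * x) (y * y) ⟩
  + (x * x) ℤ.+ + (y * y)     ≡⟨ cong₂ ℤ._+_ (ℤ.pos-* x x) (ℤ.pos-* y y) ⟩
  + x ℤ.* + x ℤ.+ + y ℤ.* + y ≡⟨ ℤ.i-j≡0⇒i≡j _ _ eq ⟩
  + z                         ∎)
  where open ≡-Reasoning

mainTheorem6 : ¬ PartitionRegular 3 sumOfSquaresMinus ×
    Σ ℕ (λ r → Σ (ℕ → Fin r) (λ χ → (i : Fin r) (x : Fin 3 → ℕ) →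
    ((k : Fin 3) → 1 ≤ x k) → ((k : Fin 3) → χ (x k) ≡ i) →
    ¬ (sumOfSquaresMinus (λ k → + (x k)) ≡ 0ℤ)))
mainTheorem6 = not-regular , (4 , colour , colour-avoids)
  where
  colour-avoids : (i : Fin 4) (x : Fin 3 → ℕ) →
    ((k : Fin 3) → 1 ≤ x k) → ((k : Fin 3) → colour (x k) ≡ i) →
    ¬ (sumOfSquaresMinus (λ k → + (x k)) ≡ 0ℤ)
  colour-avoids i x pos mono eq =
    no-monochromatic-solution (pos zero) (pos (suc zero))
      (trans (mono zero) (sym (mono (suc (suc zero)))))
      (trans (mono (suc zero)) (sym (mono (suc (suc zero)))))
      (sumOfSquaresMinus-nat (x zero) (x (suc zero)) (x (suc (suc zero))) eq)
  not-regular : ¬ PartitionRegular 3 sumOfSquaresMinus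
  not-regular regular with regular 4 colour
  ... | i , x , pos , mono , eq = colour-avoids i x pos mono eq
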